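{- Suppose that $u, s, t$ are positive integers, $n=2 \cdot 3^u$, $1 \leq s, t \leq 3^u$, and $s \neq t$. Then $\chi(C_n, \{s,t\}) \in \{2,3\}$, and both values occur (for suitable choices of such $s,t$).
   Context: $C_n$ is the cycle with vertex set $\mathbb{Z}_n=\{0,1,\dots,n-1\}$, $i$ adjacent to $i\pm1 \pmod n$; the graph distance is $\mathrm{dist}(i,j)=\min(|i-j|,\,n-|i-j|)$. For a set $D$ of positive integers, the distance graph $G(C_n,D)$ has vertex set $\mathbb{Z}_n$, with distinct $i,j$ adjacent iff $\mathrm{dist}(i,j)\in D$; $\chi(C_n,D)$ is its chromatic number. -}

module Defs where

open import Data.Nat using (ℕ; suc; _*_; _^_; _≤_; _<_; _∸_; _⊓_; ∣_-_∣)
open import Data.Fin using (Fin; toℕ)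
open import Data.Product using (Σ; ∃; _×_)
open import Data.Sum using (_⊎_)
open import Relation.Binary.PropositionalEquality using (_≡_; _≢_)
open import Relation.Nullary using (¬_)

cycDist : (n : ℕ) → Fin n → Fin n → ℕ
cycDist n i j = ∣ toℕ i - toℕ j ∣ ⊓ (n ∸ ∣ toℕ i - toℕ j ∣)

Adj : (n s t : ℕ) → Fin n → Fin n → Set
Adj n s t i j = i ≢ j × (cycDist n i j ≡ s ⊎ cycDist n i j ≡ t)

Colorable : (n s t k : ℕ) → Set
Colorable n s t k =
  Σ (Fin n → Fin k) λ c → ∀ i j → Adj n s t i j → c i ≢ c j

IsChromaticNumber : (n s t k : ℕ) → Set
IsChromaticNumber n s t k = Colorable n s t k × (∀ m → m < k → ¬ Colorable n s t m)

Admissible : (u s t : ℕ) → Set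
Admissible u s t = (1 ≤ s × s ≤ 3 ^ u) × (1 ≤ t × t ≤ 3 ^ u) × s ≢ t

-- Two colours suffice exactly when s and t are both odd: parity colours C_n properly as n is
-- even, while for even s the walk 0, s, 2s, …, 3^u s is a closed walk of odd length.
-- Three colours always suffice. Colouring x by ⌊3kx/n⌋ mod 3 is proper for every distance d
-- with kd mod n in the middle third [n/3, 2n/3], so it remains to find a common multiplier k
-- for s and t. Common factors 3 of s and t are divided out together with one of n. If then
-- 3 ∤ s and t = 3^b w with 3 ∤ w and b < u, take k = (n / 3^(b+1)) c with c prime to 3 putting
-- c s into the middle third modulo 3^(b+1); then k t = (n/3) c w lies at n/3 or 2n/3.
-- The remaining case t = 3^u forces s to be even, and k = 3^(u-1) works.

module Submission where

open import Defs
open import Data.Nat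
open import Data.Nat.Properties
open import Data.Nat.DivMod
open import Data.Nat.Divisibility
open import Data.Nat.Primality using (Prime; prime?; prime[2]; ¬prime[1]; euclidsLemma)
open import Data.Nat.Induction using (<-wellFounded)
open import Data.Nat.Tactic.RingSolver using (solve-∀)
open import Data.Fin using (Fin; toℕ; inject≤)
import Data.Fin.Properties as Fin
open import Data.Product using (Σ; ∃; ∃₂; _×_; _,_; proj₁; proj₂; map₂)
open import Data.Sum using (_⊎_; inj₁; inj₂; [_,_]′; swap)
import Data.Sum as Sum
open import Data.Empty using (⊥-elim)
open import Function using (_∘_)
open import Induction.WellFounded using (Acc; acc)
open import Relation.Nullary using (¬_; Dec; yes; no; contradiction)
open import Relation.Nullary.Decidable using (from-yes; from-no)
open import Relation.Binary.PropositionalEquality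

-- Geometry of the cycle

Clockwise : (n d a b : ℕ) → Set
Clockwise n d a b = a + d ≡ b ⊎ a + d ≡ b + n

ordered-distance⇒clockwise : ∀ {n d a b} → a ≤ b → b < n → (b ∸ a) ⊓ (n ∸ (b ∸ a)) ≡ d →
                             Clockwise n d a b ⊎ Clockwise n d b a
ordered-distance⇒clockwise {n} {d} {a} {b} a≤b b<n dist with ⊓-sel (b ∸ a) (n ∸ (b ∸ a))
... | inj₁ min≡ = inj₁ (inj₁ (begin
  a + d       ≡⟨ cong (a +_) (trans (sym dist) min≡) ⟩
  a + (b ∸ a) ≡⟨ m+[n∸m]≡n a≤b ⟩
  b           ∎))
  where open ≡-Reasoning
... | inj₂ min≡ = inj₂ (inj₂ (begin
  b + d                     ≡⟨ cong₂ _+_ (sym (m+[n∸m]≡n a≤b)) (trans (sym dist) min≡) ⟩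
  a + (b ∸ a) + (n ∸ (b ∸ a)) ≡⟨ +-assoc a (b ∸ a) _ ⟩
  a + ((b ∸ a) + (n ∸ (b ∸ a))) ≡⟨ cong (a +_) (m+[n∸m]≡n (≤-trans (m∸n≤m b a) (<⇒≤ b<n))) ⟩
  a + n                     ∎))
  where open ≡-Reasoning

cycDist≡⇒clockwise : ∀ {n d} (i j : Fin n) → cycDist n i j ≡ d →
                     Clockwise n d (toℕ i) (toℕ j) ⊎ Clockwise n d (toℕ j) (toℕ i)
cycDist≡⇒clockwise {n} {d} i j dist with ≤-total (toℕ i) (toℕ j)
... | inj₁ i≤j = ordered-distance⇒clockwise i≤j (Fin.toℕ<n j)
  (subst (λ D → D ⊓ (n ∸ D) ≡ d) (m≤n⇒∣m-n∣≡n∸m i≤j) dist)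
... | inj₂ j≤i = swap (ordered-distance⇒clockwise j≤i (Fin.toℕ<n i)
  (subst (λ D → D ⊓ (n ∸ D) ≡ d) (trans (∣-∣-comm (toℕ i) (toℕ j)) (m≤n⇒∣m-n∣≡n∸m j≤i)) dist))

2*d≤n⇒d≤n∸d : ∀ {d n} → 2 * d ≤ n → d ≤ n ∸ d
2*d≤n⇒d≤n∸d {d} {n} le = m+n≤o⇒m≤o∸n d (subst (_≤ n) (cong (d +_) (+-identityʳ d)) le)

clockwise⇒distance : ∀ {n d a b} → 2 * d ≤ n → Clockwise n d a b → ∣ a - b ∣ ⊓ (n ∸ ∣ a - b ∣) ≡ d
clockwise⇒distance {n} {d} {a} 2d≤n (inj₁ refl) = begin
  ∣ a - a + d ∣ ⊓ (n ∸ ∣ a - a + d ∣) ≡⟨ cong (λ D → D ⊓ (n ∸ D)) (∣m-m+n∣≡n a d) ⟩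
  d ⊓ (n ∸ d)                         ≡⟨ m≤n⇒m⊓n≡m (2*d≤n⇒d≤n∸d 2d≤n) ⟩
  d                                   ∎
  where open ≡-Reasoning
clockwise⇒distance {n} {d} {a} {b} 2d≤n (inj₂ wrap) = begin
  ∣ a - b ∣ ⊓ (n ∸ ∣ a - b ∣) ≡⟨ cong (λ D → D ⊓ (n ∸ D)) ∣a-b∣≡n∸d ⟩
  (n ∸ d) ⊓ (n ∸ (n ∸ d))     ≡⟨ cong ((n ∸ d) ⊓_) (m∸[m∸n]≡n d≤n) ⟩
  (n ∸ d) ⊓ d                 ≡⟨ m≥n⇒m⊓n≡n (2*d≤n⇒d≤n∸d 2d≤n) ⟩
  d                           ∎
  where
  open ≡-Reasoning
  d≤n : d ≤ n
  d≤n = m+n≤o⇒m≤o d 2d≤n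
  a≡b+[n∸d] : a ≡ b + (n ∸ d)
  a≡b+[n∸d] = +-cancelʳ-≡ d a _ (begin
    a + d             ≡⟨ wrap ⟩
    b + n             ≡⟨ cong (b +_) (sym (m∸n+n≡m d≤n)) ⟩
    b + (n ∸ d + d)   ≡⟨ sym (+-assoc b (n ∸ d) d) ⟩
    b + (n ∸ d) + d   ∎)
  ∣a-b∣≡n∸d : ∣ a - b ∣ ≡ n ∸ d
  ∣a-b∣≡n∸d = begin
    ∣ a - b ∣           ≡⟨ cong ∣_- b ∣ a≡b+[n∸d] ⟩
    ∣ b + (n ∸ d) - b ∣ ≡⟨ ∣-∣-comm (b + (n ∸ d)) b ⟩
    ∣ b - b + (n ∸ d) ∣ ≡⟨ ∣m-m+n∣≡n b (n ∸ d) ⟩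
    n ∸ d               ∎

[m+o]%n≡[m%n+o]%n : ∀ m o n .{{_ : NonZero n}} → (m + o) % n ≡ (m % n + o) % n
[m+o]%n≡[m%n+o]%n m o n = begin
  (m + o) % n               ≡⟨ %-distribˡ-+ m o n ⟩
  (m % n + o % n) % n       ≡⟨ cong (λ y → (y + o % n) % n) (m%n%n≡m%n m n) ⟨
  (m % n % n + o % n) % n   ≡⟨ %-distribˡ-+ (m % n) o n ⟨
  (m % n + o) % n           ∎
  where open ≡-Reasoning

clockwise-% : ∀ n .{{_ : NonZero n}} d → d ≤ n → ∀ a → a < n → Clockwise n d a ((a + d) % n)
clockwise-% n d d≤n a a<n with a + d <? n
... | yes inside = inj₁ (sym (m<n⇒m%n≡m inside))
... | no outside = inj₂ (begin
  a + d             ≡⟨ m∸n+n≡m n≤a+d ⟨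
  a + d ∸ n + n     ≡⟨ cong (_+ n) (m<n⇒m%n≡m a+d∸n<n) ⟨
  (a + d ∸ n) % n + n ≡⟨ cong (_+ n) (m≤n⇒[n∸m]%m≡n%m n≤a+d) ⟩
  (a + d) % n + n   ∎)
  where
  open ≡-Reasoning
  n≤a+d : n ≤ a + d
  n≤a+d = ≮⇒≥ outside
  a+d∸n<n : a + d ∸ n < n
  a+d∸n<n = m<n+o⇒m∸n<o (a + d) n (+-mono-<-≤ a<n d≤n)

%-clockwise : ∀ n .{{_ : NonZero n}} d → d ≤ n → ∀ x → Clockwise n d (x % n) ((x + d) % n)
%-clockwise n d d≤n x =
  subst (Clockwise n d (x % n)) (sym ([m+o]%n≡[m%n+o]%n x d n)) (clockwise-% n d d≤n (x % n) (m%n<n x n))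

cycDist-self : ∀ {n} (i : Fin n) → cycDist n i i ≡ 0
cycDist-self {n} i = cong (λ D → D ⊓ (n ∸ D)) (∣n-n∣≡0 (toℕ i))

step-adjacent : ∀ n .{{_ : NonZero n}} {d} t → 0 < d → 2 * d ≤ n →
                ∀ x → Adj n d t (x mod n) ((x + d) mod n)
step-adjacent n {d} t 0<d 2d≤n x = distinct , inj₁ dist≡d
  where
  dist≡d : cycDist n (x mod n) ((x + d) mod n) ≡ d
  dist≡d rewrite Fin.toℕ-fromℕ< (m%n<n x n) | Fin.toℕ-fromℕ< (m%n<n (x + d) n) =
    clockwise⇒distance 2d≤n (%-clockwise n d (m+n≤o⇒m≤o d 2d≤n) x)
  distinct : x mod n ≢ (x + d) mod n
  distinct same = <⇒≢ 0<d (begin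
    0                                  ≡⟨ cycDist-self (x mod n) ⟨
    cycDist n (x mod n) (x mod n)      ≡⟨ cong (cycDist n (x mod n)) same ⟩
    cycDist n (x mod n) ((x + d) mod n) ≡⟨ dist≡d ⟩
    d                                  ∎)
    where open ≡-Reasoning

-- Colourings

colorable-mono : ∀ {n s t m m′} → m ≤ m′ → Colorable n s t m → Colorable n s t m′
colorable-mono m≤m′ (c , proper) = (λ i → inject≤ (c i) m≤m′) , λ i j adj same →
  proper i j adj (Fin.toℕ-injective (begin
    toℕ (c i)                ≡⟨ Fin.toℕ-inject≤ (c i) m≤m′ ⟨
    toℕ (inject≤ (c i) m≤m′) ≡⟨ cong toℕ same ⟩
    toℕ (inject≤ (c j) m≤m′) ≡⟨ Fin.toℕ-inject≤ (c j) m≤m′ ⟩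
    toℕ (c j)                ∎))
  where open ≡-Reasoning

colorable-swap : ∀ {n s t m} → Colorable n s t m → Colorable n t s m
colorable-swap (c , proper) = c , λ i j adj → proper i j (map₂ swap adj)

chromatic : ∀ {n s t k} → Colorable n s t (suc k) → ¬ Colorable n s t k → IsChromaticNumber n s t (suc k)
chromatic col ¬col = col , λ m m<1+k col′ → ¬col (colorable-mono (s≤s⁻¹ m<1+k) col′)

¬1-colorable : ∀ n .{{_ : NonZero n}} {s} t → 0 < s → 2 * s ≤ n → ¬ Colorable n s t 1
¬1-colorable n t 0<s 2s≤n (c , proper) = proper _ _ (step-adjacent n t 0<s 2s≤n 0) (fin1 _ _)
  where
  fin1 : (a b : Fin 1) → a ≡ b
  fin1 Fin.zero Fin.zero = refl

2-colours-alternate : {a b c : Fin 2} → a ≢ b → b ≢ c → a ≡ c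
2-colours-alternate {Fin.zero} {Fin.zero} a≢b _ = contradiction refl a≢b
2-colours-alternate {Fin.zero} {Fin.suc Fin.zero} {Fin.zero} _ _ = refl
2-colours-alternate {Fin.zero} {Fin.suc Fin.zero} {Fin.suc Fin.zero} _ b≢c = contradiction refl b≢c
2-colours-alternate {Fin.suc Fin.zero} {Fin.suc Fin.zero} a≢b _ = contradiction refl a≢b
2-colours-alternate {Fin.suc Fin.zero} {Fin.zero} {Fin.zero} _ b≢c = contradiction refl b≢c
2-colours-alternate {Fin.suc Fin.zero} {Fin.zero} {Fin.suc Fin.zero} _ _ = refl

odd⇒%2≡1 : ∀ {N} → 2 ∤ N → N % 2 ≡ 1
odd⇒%2≡1 {N} 2∤N with N % 2 | m%n<n N 2 | m%n≡0⇒n∣m N 2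
... | 0 | _ | 2∣N = contradiction (2∣N refl) 2∤N
... | 1 | _ | _ = refl
... | suc (suc _) | s≤s (s≤s ()) | _

-- The walk 0, s, 2s, …, N s closes up in C_n; if N is odd it is an odd closed walk.
¬2-colorable : ∀ n .{{_ : NonZero n}} {s} t N → 0 < s → 2 * s ≤ n → 2 ∤ N → n ∣ N * s →
               ¬ Colorable n s t 2
¬2-colorable n {s} t N 0<s 2s≤n 2∤N n∣Ns (c , proper) =
  proper _ _ (step-adjacent n t 0<s 2s≤n (half * (s + s))) (begin
    colour (half * (s + s))      ≡⟨ even-steps half ⟩
    colour 0                     ≡⟨ cong c (Fin.fromℕ<-cong _ _ closes _ _) ⟩
    colour (N * s)               ≡⟨ cong colour N*s≡ ⟩
    colour (half * (s + s) + s)  ∎)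
  where
  open ≡-Reasoning
  colour : ℕ → Fin 2
  colour x = c (x mod n)
  closes : 0 % n ≡ (N * s) % n
  closes = trans (m<n⇒m%n≡m (>-nonZero⁻¹ n)) (sym (n∣m⇒m%n≡0 _ n n∣Ns))
  half = N / 2
  step : ∀ x → colour x ≢ colour (x + s)
  step x = proper _ _ (step-adjacent n t 0<s 2s≤n x)
  even-steps : ∀ j → colour (j * (s + s)) ≡ colour 0
  even-steps zero = refl
  even-steps (suc j) = begin
    colour (s + s + y)  ≡⟨ cong colour (trans (+-comm (s + s) y) (sym (+-assoc y s s))) ⟩
    colour (y + s + s)  ≡⟨ 2-colours-alternate (≢-sym (step (y + s))) (≢-sym (step y)) ⟩
    colour y            ≡⟨ even-steps j ⟩
    colour 0            ∎
    where y = j * (s + s)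
  N*s≡ : N * s ≡ half * (s + s) + s
  N*s≡ = begin
    N * s                  ≡⟨ cong (_* s) (m≡m%n+[m/n]*n N 2) ⟩
    (N % 2 + half * 2) * s ≡⟨ cong (λ r → (r + half * 2) * s) (odd⇒%2≡1 2∤N) ⟩
    (1 + half * 2) * s     ≡⟨ regroup half s ⟩
    half * (s + s) + s     ∎
    where
    regroup : ∀ h s → (1 + h * 2) * s ≡ h * (s + s) + s
    regroup = solve-∀

%-+-≢ : ∀ d .{{_ : NonZero d}} m n → d ∤ n → (m + n) % d ≢ m % d
%-+-≢ d m n d∤n same = d∤n (∣m+n∣m⇒∣n (divides ((m + n) / d) shifted) (n∣m*n (m / d)))
  where
  open ≡-Reasoning
  shifted : m / d * d + n ≡ (m + n) / d * d
  shifted = +-cancelˡ-≡ (m % d) _ _ (begin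
    m % d + (m / d * d + n)   ≡⟨ +-assoc (m % d) _ n ⟨
    m % d + m / d * d + n     ≡⟨ cong (_+ n) (m≡m%n+[m/n]*n m d) ⟨
    m + n                     ≡⟨ m≡m%n+[m/n]*n (m + n) d ⟩
    (m + n) % d + (m + n) / d * d ≡⟨ cong (_+ (m + n) / d * d) same ⟩
    m % d + (m + n) / d * d   ∎)

Apart : (m : ℕ) .{{_ : NonZero m}} → (ℕ → ℕ) → ℕ → Set
Apart m f d = ∀ x → f (x + d) % m ≢ f x % m

colorable-by : ∀ {n s t m} .{{_ : NonZero m}} (f : ℕ → ℕ) → (∀ y → f (y + n) % m ≡ f y % m) →
               Apart m f s → Apart m f t → Colorable n s t m
colorable-by {n} {s} {t} {m} f periodic s-apart t-apart = colour , proper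
  where
  colour : Fin n → Fin m
  colour i = f (toℕ i) mod m
  toℕ-colour : ∀ i → toℕ (colour i) ≡ f (toℕ i) % m
  toℕ-colour i = Fin.toℕ-fromℕ< (m%n<n (f (toℕ i)) m)
  clockwise-apart : ∀ {d a b} → Apart m f d → Clockwise n d a b → f b % m ≢ f a % m
  clockwise-apart apart (inj₁ refl) = apart _
  clockwise-apart {a = a} {b} apart (inj₂ wrap) same =
    apart a (trans (cong (λ y → f y % m) wrap) (trans (periodic b) same))
  apart : ∀ {d} → Apart m f d → ∀ i j → cycDist n i j ≡ d →
          f (toℕ i) % m ≢ f (toℕ j) % m
  apart d-apart i j dist with cycDist≡⇒clockwise i j dist
  ... | inj₁ i↻j = ≢-sym (clockwise-apart d-apart i↻j)
  ... | inj₂ j↻i = clockwise-apart d-apart j↻i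
  proper : ∀ i j → Adj n s t i j → colour i ≢ colour j
  proper i j (_ , dist) same =
    [ apart s-apart i j , apart t-apart i j ]′ dist
      (trans (sym (toℕ-colour i)) (trans (cong toℕ same) (toℕ-colour j)))

parity-colorable : ∀ {n s t} → 2 ∣ n → 2 ∤ s → 2 ∤ t → Colorable n s t 2
parity-colorable {n} {s} {t} 2∣n 2∤s 2∤t =
  colorable-by (λ x → x) (λ y → %-remove-+ʳ y 2∣n) (λ x → %-+-≢ 2 x s 2∤s) (λ x → %-+-≢ 2 x t 2∤t)

record MiddleThird (n x : ℕ) : Set where
  constructor middleThird
  field
    residue quotient : ℕ
    decomposition : x ≡ residue + quotient * n
    lower : n ≤ 3 * residue
    upper : 3 * residue ≤ 2 * n

-- ⌊3kx/n⌋ mod 3 wraps C_n k times around a triangle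
stretch : (n : ℕ) .{{_ : NonZero n}} → ℕ → ℕ → ℕ
stretch n k x = 3 * k * x / n

stretch-periodic : ∀ n .{{_ : NonZero n}} k y → stretch n k (y + n) % 3 ≡ stretch n k y % 3
stretch-periodic n k y = begin
  3 * k * (y + n) / n % 3               ≡⟨ cong (λ z → z / n % 3) (*-distribˡ-+ (3 * k) y n) ⟩
  (3 * k * y + 3 * k * n) / n % 3       ≡⟨ cong (_% 3) (+-distrib-/-∣ʳ (3 * k * y) (n∣m*n (3 * k))) ⟩
  (stretch n k y + 3 * k * n / n) % 3   ≡⟨ cong (λ z → (stretch n k y + z) % 3) (m*n/n≡m (3 * k) n) ⟩
  (stretch n k y + 3 * k) % 3           ≡⟨ %-remove-+ʳ (stretch n k y) (m∣m*n k) ⟩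
  stretch n k y % 3                     ∎
  where open ≡-Reasoning

stretch-apart : ∀ n .{{_ : NonZero n}} k d → MiddleThird n (k * d) → Apart 3 (stretch n k) d
stretch-apart n k d (middleThird r q kd≡ lower upper) x same =
  %-+-≢ 3 a (q * 3 + e) 3∤jump (trans (cong (_% 3) (sym jump)) same)
  where
  open ≡-Reasoning
  α = 3 * k * x % n
  a = stretch n k x
  e = (α + 3 * r) / n
  expand : 3 * k * (x + d) ≡ (α + 3 * r) + (a + q * 3) * n
  expand = begin
    3 * k * (x + d)               ≡⟨ distrib k x d ⟩
    3 * k * x + 3 * (k * d)       ≡⟨ cong₂ (λ u v → u + 3 * v) (m≡m%n+[m/n]*n (3 * k * x) n) kd≡ ⟩
    α + a * n + 3 * (r + q * n)   ≡⟨ regroup α a n r q ⟩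
    α + 3 * r + (a + q * 3) * n   ∎
    where
    distrib : ∀ k x d → 3 * k * (x + d) ≡ 3 * k * x + 3 * (k * d)
    distrib = solve-∀
    regroup : ∀ α a n r q → α + a * n + 3 * (r + q * n) ≡ α + 3 * r + (a + q * 3) * n
    regroup = solve-∀
  jump : stretch n k (x + d) ≡ a + (q * 3 + e)
  jump = begin
    3 * k * (x + d) / n                        ≡⟨ cong (_/ n) expand ⟩
    (α + 3 * r + (a + q * 3) * n) / n          ≡⟨ +-distrib-/-∣ʳ (α + 3 * r) (n∣m*n (a + q * 3)) ⟩
    e + (a + q * 3) * n / n                    ≡⟨ cong (e +_) (m*n/n≡m (a + q * 3) n) ⟩
    e + (a + q * 3)                            ≡⟨ rotate e a (q * 3) ⟩
    a + (q * 3 + e)                            ∎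
    where
    rotate : ∀ e a b → e + (a + b) ≡ a + (b + e)
    rotate = solve-∀
  -- n ≤ α + 3r < 3n, so the colour advances by 1 or 2
  1≤e : 1 ≤ e
  1≤e = m≥n⇒m/n>0 (≤-trans lower (m≤n+m (3 * r) α))
  e<3 : e < 3
  e<3 = m<n*o⇒m/o<n (+-mono-<-≤ (m%n<n (3 * k * x) n) upper)
  3∤jump : 3 ∤ q * 3 + e
  3∤jump 3∣ = <⇒≱ e<3 (∣⇒≤ {{>-nonZero 1≤e}} (∣m+n∣m⇒∣n 3∣ (n∣m*n q)))

middleThird-colorable : ∀ n .{{_ : NonZero n}} {s t} k → MiddleThird n (k * s) → MiddleThird n (k * t) →
                        Colorable n s t 3
middleThird-colorable n {s} {t} k s-mid t-mid =
  colorable-by (stretch n k) (stretch-periodic n k) (stretch-apart n k s s-mid) (stretch-apart n k t t-mid)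

-- Arithmetic of the middle third

middleThird-*ˡ : ∀ K {P x} → MiddleThird P x → MiddleThird (K * P) (K * x)
middleThird-*ˡ K {P} {x} (middleThird r q x≡ lower upper) = middleThird (K * r) q
  (trans (cong (K *_) x≡) (distrib K r q P))
  (≤-trans (*-monoʳ-≤ K lower) (≤-reflexive (swap₃ K r)))
  (≤-trans (≤-reflexive (sym (swap₃ K r))) (≤-trans (*-monoʳ-≤ K upper) (≤-reflexive (swap₂ K P))))
  where
  distrib : ∀ K r q P → K * (r + q * P) ≡ K * r + q * (K * P)
  distrib = solve-∀
  swap₃ : ∀ K r → K * (3 * r) ≡ 3 * (K * r)
  swap₃ = solve-∀
  swap₂ : ∀ K P → K * (2 * P) ≡ 2 * (K * P)
  swap₂ = solve-∀

middleThird-+ : ∀ {P x} m → MiddleThird P x → MiddleThird P (x + m * P)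
middleThird-+ {P} {x} m (middleThird r q x≡ lower upper) =
  middleThird r (q + m) (trans (cong (_+ m * P) x≡) (regroup r q m P)) lower upper
  where
  regroup : ∀ r q m P → r + q * P + m * P ≡ r + (q + m) * P
  regroup = solve-∀

middleThird-small : ∀ P .{{_ : NonZero P}} x → P ≤ 3 → P ∤ x → MiddleThird P x
middleThird-small P x P≤3 P∤x = middleThird r (x / P) (m≡m%n+[m/n]*n x P) lower upper
  where
  r = x % P
  1≤r : 1 ≤ r
  1≤r = n≢0⇒n>0 (P∤x ∘ m%n≡0⇒n∣m x P)
  lower : P ≤ 3 * r
  lower = ≤-trans P≤3 (*-monoʳ-≤ 3 1≤r)
  upper : 3 * r ≤ 2 * P
  upper = +-cancelˡ-≤ 3 _ _ (begin
    3 + 3 * r   ≡⟨ *-suc 3 r ⟨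
    3 * suc r   ≤⟨ *-monoʳ-≤ 3 (m%n<n x P) ⟩
    P + 2 * P   ≤⟨ +-monoˡ-≤ (2 * P) P≤3 ⟩
    3 + 2 * P   ∎)
    where open ≤-Reasoning

middleThird-3* : ∀ {Q x} r q → x ≡ r + q * (3 * Q) → Q ≤ r → r ≤ 2 * Q → MiddleThird (3 * Q) x
middleThird-3* {Q} r q x≡ Q≤r r≤2Q = middleThird r q x≡ (*-monoʳ-≤ 3 Q≤r)
  (≤-trans (*-monoʳ-≤ 3 r≤2Q) (≤-reflexive (commute Q)))
  where
  commute : ∀ Q → 3 * (2 * Q) ≡ 2 * (3 * Q)
  commute = solve-∀

-- c = ⌊Q/s₀⌋ + 1, or ⌊Q/s₀⌋ + 2 when 3 divides the former (then ⌊Q/s₀⌋ ≥ 2 leaves room)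
small-multiplier : ∀ Q s₀ → 0 < s₀ → s₀ ≤ Q → ∃ λ c → 3 ∤ c × Q ≤ c * s₀ × c * s₀ ≤ 2 * Q
small-multiplier Q s₀ 0<s₀ s₀≤Q = choose (3 ∣? suc c₀)
  where
  instance
    s₀≢0 : NonZero s₀
    s₀≢0 = >-nonZero 0<s₀
  open ≤-Reasoning
  c₀ = Q / s₀
  c₀s₀≤Q : c₀ * s₀ ≤ Q
  c₀s₀≤Q = m/n*n≤m Q s₀
  Q+Q≡2Q : Q + Q ≡ 2 * Q
  Q+Q≡2Q = cong (Q +_) (sym (+-identityʳ Q))
  beyond : Q ≤ suc c₀ * s₀
  beyond = begin
    Q                ≡⟨ m≡m%n+[m/n]*n Q s₀ ⟩
    Q % s₀ + c₀ * s₀ ≤⟨ +-monoˡ-≤ (c₀ * s₀) (<⇒≤ (m%n<n Q s₀)) ⟩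
    s₀ + c₀ * s₀     ∎
  choose : Dec (3 ∣ suc c₀) → ∃ λ c → 3 ∤ c × Q ≤ c * s₀ × c * s₀ ≤ 2 * Q
  choose (no 3∤c) = suc c₀ , 3∤c , beyond , (begin
    s₀ + c₀ * s₀     ≤⟨ +-mono-≤ s₀≤Q c₀s₀≤Q ⟩
    Q + Q            ≡⟨ Q+Q≡2Q ⟩
    2 * Q            ∎)
  choose (yes 3∣c) = suc (suc c₀) , 3∤c+1 , ≤-trans beyond (m≤n+m _ s₀) , (begin
    s₀ + (s₀ + c₀ * s₀)  ≡⟨ +-assoc s₀ s₀ _ ⟨
    s₀ + s₀ + c₀ * s₀    ≤⟨ +-monoˡ-≤ (c₀ * s₀) 2s₀≤Q ⟩
    Q + c₀ * s₀          ≤⟨ +-monoʳ-≤ Q c₀s₀≤Q ⟩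
    Q + Q                ≡⟨ Q+Q≡2Q ⟩
    2 * Q                ∎)
    where
    2≤c₀ : 2 ≤ c₀
    2≤c₀ = s≤s⁻¹ (∣⇒≤ 3∣c)
    2s₀≤Q : s₀ + s₀ ≤ Q
    2s₀≤Q = ≤-trans (≤-reflexive (cong (s₀ +_) (sym (+-identityʳ s₀))))
                    (≤-trans (*-monoˡ-≤ s₀ 2≤c₀) c₀s₀≤Q)
    3∤c+1 : 3 ∤ suc (suc c₀)
    3∤c+1 3∣c+1 with ∣1⇒≡1 (∣m+n∣m⇒∣n (subst (3 ∣_) (+-comm 1 (suc c₀)) 3∣c+1) 3∣c)
    ... | ()

-- For s₀ > 2Q the multiplier of 3Q − s₀ serves, the middle third being symmetric under negation.
residue-multiplier : ∀ Q s₀ → 0 < s₀ → s₀ < 3 * Q → ∃ λ c → 3 ∤ c × MiddleThird (3 * Q) (c * s₀)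
residue-multiplier Q s₀ 0<s₀ s₀<3Q with s₀ ≤? Q | s₀ ≤? 2 * Q
... | yes s₀≤Q | _ with small-multiplier Q s₀ 0<s₀ s₀≤Q
...   | c , 3∤c , lower , upper = c , 3∤c , middleThird-3* (c * s₀) 0 (sym (+-identityʳ _)) lower upper
residue-multiplier Q s₀ 0<s₀ s₀<3Q | no s₀≰Q | yes s₀≤2Q =
  1 , from-no (3 ∣? 1) , middleThird-3* s₀ 0 refl (<⇒≤ (≰⇒> s₀≰Q)) s₀≤2Q
residue-multiplier Q s₀ 0<s₀ s₀<3Q | no _ | no s₀≰2Q = reflected
  where
  s₁ = 3 * Q ∸ s₀
  s₀+s₁≡3Q : s₀ + s₁ ≡ 3 * Q
  s₀+s₁≡3Q = m+[n∸m]≡n (<⇒≤ s₀<3Q)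
  s₁≤Q : s₁ ≤ Q
  s₁≤Q = ≤-trans (∸-monoʳ-≤ (3 * Q) (<⇒≤ (≰⇒> s₀≰2Q))) (≤-reflexive (m+n∸n≡m Q (2 * Q)))
  reflected : ∃ λ c → 3 ∤ c × MiddleThird (3 * Q) (c * s₀)
  reflected with small-multiplier Q s₁ (m<n⇒0<n∸m s₀<3Q) s₁≤Q
  ... | zero , 3∤0 , _ = contradiction (divides 0 refl) 3∤0
  ... | suc c′ , 3∤c , lower , upper = suc c′ , 3∤c , middleThird-3* r c′ decomposition Q≤r r≤2Q
    where
    open ≡-Reasoning
    c = suc c′
    r = 3 * Q ∸ c * s₁
    r+cs₁≡3Q : r + c * s₁ ≡ 3 * Q
    r+cs₁≡3Q = m∸n+n≡m (≤-trans upper (m≤n+m (2 * Q) Q))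
    decomposition : c * s₀ ≡ r + c′ * (3 * Q)
    decomposition = +-cancelʳ-≡ (c * s₁) _ _ (begin
      c * s₀ + c * s₁              ≡⟨ *-distribˡ-+ c s₀ s₁ ⟨
      c * (s₀ + s₁)                ≡⟨ cong (c *_) s₀+s₁≡3Q ⟩
      3 * Q + c′ * (3 * Q)         ≡⟨ cong (_+ c′ * (3 * Q)) r+cs₁≡3Q ⟨
      r + c * s₁ + c′ * (3 * Q)    ≡⟨ exchange r (c * s₁) _ ⟩
      r + c′ * (3 * Q) + c * s₁    ∎)
      where
      exchange : ∀ x y z → x + y + z ≡ x + z + y
      exchange = solve-∀
    Q≤r : Q ≤ r
    Q≤r = ≤-trans (≤-reflexive (sym (m+n∸n≡m Q (2 * Q)))) (∸-monoʳ-≤ (3 * Q) upper)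
    r≤2Q : r ≤ 2 * Q
    r≤2Q = ≤-trans (∸-monoʳ-≤ (3 * Q) lower) (≤-reflexive (m+n∸m≡n Q (2 * Q)))

-- Divisibility by 2 and 3

prime[3] : Prime 3
prime[3] = from-yes (prime? 3)

2∤3 : 2 ∤ 3
2∤3 = from-no (2 ∣? 3)

prime-∤-* : ∀ {p m n} → Prime p → p ∤ m → p ∤ n → p ∤ m * n
prime-∤-* {m = m} {n} p-prime p∤m p∤n = [ p∤m , p∤n ]′ ∘ euclidsLemma m n p-prime

prime-∤-^ : ∀ {p m} → Prime p → p ∤ m → ∀ k → p ∤ m ^ k
prime-∤-^ p-prime p∤m zero p∣1 = ¬prime[1] (subst Prime (∣1⇒≡1 p∣1) p-prime)
prime-∤-^ p-prime p∤m (suc k) = prime-∤-* p-prime p∤m (prime-∤-^ p-prime p∤m k)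

3-adic : ∀ t → 0 < t → ∃₂ λ b w → t ≡ 3 ^ b * w × 3 ∤ w
3-adic t = go t (<-wellFounded t)
  where
  go : ∀ t → Acc _<_ t → 0 < t → ∃₂ λ b w → t ≡ 3 ^ b * w × 3 ∤ w
  go t (acc smaller) 0<t with 3 ∣? t
  ... | no 3∤t = 0 , t , sym (+-identityʳ t) , 3∤t
  ... | yes (divides zero t≡0) = contradiction t≡0 (≢-sym (<⇒≢ 0<t))
  ... | yes (divides t′@(suc _) t≡t′*3)
    with go t′ (smaller (subst (t′ <_) (sym t≡t′*3) (m<m*n t′ 3 (s≤s (s≤s z≤n))))) z<s
  ...   | b , w , t′≡ , 3∤w =
    suc b , w , trans t≡t′*3 (trans (cong (_* 3) t′≡) (regroup (3 ^ b) w)) , 3∤w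
    where
    regroup : ∀ x w → x * w * 3 ≡ 3 * x * w
    regroup = solve-∀

MiddleMultiplier : ℕ → ℕ → ℕ → Set
MiddleMultiplier n s t = ∃ λ k → MiddleThird n (k * s) × MiddleThird n (k * t)

middleMultiplier-swap : ∀ {n s t} → MiddleMultiplier n s t → MiddleMultiplier n t s
middleMultiplier-swap (k , s-mid , t-mid) = k , t-mid , s-mid

middleMultiplier-* : ∀ K {n s t} → MiddleMultiplier n s t → MiddleMultiplier (K * n) (s * K) (t * K)
middleMultiplier-* K {n} {s} {t} (k , s-mid , t-mid) = k , scale s s-mid , scale t t-mid
  where
  scale : ∀ d → MiddleThird n (k * d) → MiddleThird (K * n) (k * (d * K))
  scale d mid = subst (MiddleThird (K * n)) (commute K k d) (middleThird-*ˡ K mid)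
    where
    commute : ∀ K k d → K * (k * d) ≡ k * (d * K)
    commute = solve-∀

middleMultiplier-3∤ : ∀ M Q .{{_ : NonZero Q}} {s w} → 3 ∤ s → 3 ∤ w →
                      MiddleMultiplier (M * (3 * Q)) s (Q * w)
middleMultiplier-3∤ M Q {s} {w} 3∤s 3∤w = build (residue-multiplier Q (s % P) 0<s₀ (m%n<n s P))
  where
  P = 3 * Q
  instance
    P≢0 : NonZero P
    P≢0 = m*n≢0 3 Q
  0<s₀ : 0 < s % P
  0<s₀ = n≢0⇒n>0 (3∤s ∘ m*n∣⇒m∣ 3 Q ∘ m%n≡0⇒n∣m s P)
  build : (∃ λ c → 3 ∤ c × MiddleThird P (c * (s % P))) → MiddleMultiplier (M * P) s (Q * w)
  build (c , 3∤c , mid) = M * c , s-mid , w-mid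
    where
    s-mid : MiddleThird (M * P) (M * c * s)
    s-mid = subst (MiddleThird (M * P))
      (sym (trans (cong (M * c *_) (m≡m%n+[m/n]*n s P)) (distrib M c (s % P) (s / P) P)))
      (middleThird-*ˡ M (middleThird-+ (c * (s / P)) mid))
      where
      distrib : ∀ M c a b P → M * c * (a + b * P) ≡ M * (c * a + c * b * P)
      distrib = solve-∀
    w-mid : MiddleThird (M * P) (M * c * (Q * w))
    w-mid = subst₂ MiddleThird (regroup₁ M Q) (regroup₂ M Q c w)
      (middleThird-*ˡ (M * Q) (middleThird-small 3 (c * w) ≤-refl (prime-∤-* prime[3] 3∤c 3∤w)))
      where
      regroup₁ : ∀ M Q → M * Q * 3 ≡ M * (3 * Q)
      regroup₁ = solve-∀
      regroup₂ : ∀ M Q c w → M * Q * (c * w) ≡ M * c * (Q * w)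
      regroup₂ = solve-∀

-- Common multipliers for the distances of the theorem

¬admissible-zero : ∀ {s t} → ¬ Admissible 0 s t
¬admissible-zero ((1≤s , s≤1) , (1≤t , t≤1) , s≢t) = s≢t (trans (≤-antisym s≤1 1≤s) (≤-antisym 1≤t t≤1))

admissible-swap : ∀ {u s t} → Admissible u s t → Admissible u t s
admissible-swap (s-range , t-range , s≢t) = t-range , s-range , ≢-sym s≢t

admissible-/3 : ∀ {v s t} → Admissible (suc v) (s * 3) (t * 3) → Admissible v s t
admissible-/3 {v} {s} {t} ((1≤3s , 3s≤) , (1≤3t , 3t≤) , 3s≢3t) =
  (positive s 1≤3s , shrink s 3s≤) , (positive t 1≤3t , shrink t 3t≤) , 3s≢3t ∘ cong (_* 3)
  where
  positive : ∀ d → 1 ≤ d * 3 → 1 ≤ d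
  positive (suc _) _ = s≤s z≤n
  shrink : ∀ d → d * 3 ≤ 3 ^ suc v → d ≤ 3 ^ v
  shrink d le = *-cancelʳ-≤ d (3 ^ v) 3 (subst (d * 3 ≤_) (*-comm 3 (3 ^ v)) le)

2∣*3⇒2∣ : ∀ {d} → 2 ∣ d * 3 → 2 ∣ d
2∣*3⇒2∣ {d} 2∣3d = [ (λ 2∣d → 2∣d) , (λ 2∣3 → contradiction 2∣3 2∤3) ]′ (euclidsLemma d 3 prime[2] 2∣3d)

middleMultiplier-half : ∀ v {s} → 2 ∣ s → 3 ∤ s → MiddleMultiplier (2 * 3 ^ suc v) s (3 ^ suc v)
middleMultiplier-half v {s} (divides s′ refl) 3∤s = 3 ^ v , s-mid , t-mid
  where
  s-mid : MiddleThird (2 * 3 ^ suc v) (3 ^ v * (s′ * 2))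
  s-mid = subst₂ MiddleThird (regroup₁ (3 ^ v)) (regroup₂ (3 ^ v) s′)
    (middleThird-*ˡ (2 * 3 ^ v) (middleThird-small 3 s′ ≤-refl (3∤s ∘ ∣m⇒∣m*n 2)))
    where
    regroup₁ : ∀ x → 2 * x * 3 ≡ 2 * (3 * x)
    regroup₁ = solve-∀
    regroup₂ : ∀ x s′ → 2 * x * s′ ≡ x * (s′ * 2)
    regroup₂ = solve-∀
  t-mid : MiddleThird (2 * 3 ^ suc v) (3 ^ v * 3 ^ suc v)
  t-mid = subst₂ MiddleThird (*-comm (3 ^ suc v) 2) (*-comm (3 ^ suc v) (3 ^ v))
    (middleThird-*ˡ (3 ^ suc v) (middleThird-small 2 (3 ^ v) (n≤1+n 2) (prime-∤-^ prime[2] 2∤3 v)))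

middleMultiplier-coprime : ∀ v {s t} → Admissible (suc v) s t → 2 ∣ s ⊎ 2 ∣ t → 3 ∤ s →
                           MiddleMultiplier (2 * 3 ^ suc v) s t
middleMultiplier-coprime v {s} {t} (_ , (1≤t , t≤3^u) , _) even 3∤s = from-3-adic (3-adic t 1≤t)
  where
  from-3-adic : (∃₂ λ b w → t ≡ 3 ^ b * w × 3 ∤ w) → MiddleMultiplier (2 * 3 ^ suc v) s t
  from-3-adic (b , w , t≡ , 3∤w) with b ≤? v
  ... | yes b≤v = subst₂ (λ n → MiddleMultiplier n s) n≡ (sym t≡)
    (middleMultiplier-3∤ (2 * 3 ^ (v ∸ b)) (3 ^ b) {{m^n≢0 3 b}} 3∤s 3∤w)
    where
    regroup : ∀ x y → 2 * x * (3 * y) ≡ 2 * (3 * (x * y))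
    regroup = solve-∀
    n≡ : 2 * 3 ^ (v ∸ b) * (3 * 3 ^ b) ≡ 2 * 3 ^ suc v
    n≡ = trans (regroup (3 ^ (v ∸ b)) (3 ^ b))
      (cong (λ x → 2 * (3 * x)) (trans (sym (^-distribˡ-+-* 3 (v ∸ b) b)) (cong (3 ^_) (m∸n+n≡m b≤v))))
  ... | no b≰v = subst (MiddleMultiplier _ s) (sym t≡3^u)
    (middleMultiplier-half v (even-s (2∤3^u ∘ subst (2 ∣_) t≡3^u)) 3∤s)
    where
    instance
      w≢0 : NonZero w
      w≢0 = ≢-nonZero λ w≡0 → 3∤w (subst (3 ∣_) (sym w≡0) (divides 0 refl))
    t≡3^u : t ≡ 3 ^ suc v
    t≡3^u = ≤-antisym t≤3^u
      (≤-trans (^-monoʳ-≤ 3 (≰⇒> b≰v)) (≤-trans (m≤m*n (3 ^ b) w) (≤-reflexive (sym t≡))))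
    2∤3^u : 2 ∤ 3 ^ suc v
    2∤3^u = prime-∤-^ prime[2] 2∤3 (suc v)
    even-s : 2 ∤ t → 2 ∣ s
    even-s 2∤t = [ (λ 2∣s → 2∣s) , (λ 2∣t → contradiction 2∣t 2∤t) ]′ even

middleMultiplier : ∀ u {s t} → Admissible u s t → 2 ∣ s ⊎ 2 ∣ t → MiddleMultiplier (2 * 3 ^ u) s t
middleMultiplier zero adm _ = ⊥-elim (¬admissible-zero adm)
middleMultiplier (suc v) {s} {t} adm even with 3 ∣? s | 3 ∣? t
... | no 3∤s | _ = middleMultiplier-coprime v adm even 3∤s
... | yes _ | no 3∤t =
  middleMultiplier-swap (middleMultiplier-coprime v (admissible-swap {suc v} adm) (swap even) 3∤t)
... | yes (divides-refl s′) | yes (divides-refl t′) =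
  subst (λ n → MiddleMultiplier n (s′ * 3) (t′ * 3)) (commute (3 ^ v))
    (middleMultiplier-* 3
      (middleMultiplier v (admissible-/3 {v} {s′} {t′} adm) (Sum.map 2∣*3⇒2∣ 2∣*3⇒2∣ even)))
  where
  commute : ∀ x → 3 * (2 * x) ≡ 2 * (3 * x)
  commute = solve-∀

-- The chromatic number

module _ (u : ℕ) {s t : ℕ} (adm : Admissible u s t) where

  private
    n = 2 * 3 ^ u
    instance
      n≢0 : NonZero n
      n≢0 = m*n≢0 2 (3 ^ u) {{_}} {{m^n≢0 3 u}}
    1≤s = proj₁ (proj₁ adm)
    1≤t = proj₁ (proj₁ (proj₂ adm))
    2s≤n = *-monoʳ-≤ 2 (proj₂ (proj₁ adm))
    2t≤n = *-monoʳ-≤ 2 (proj₂ (proj₁ (proj₂ adm)))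

  χ-odd : 2 ∤ s → 2 ∤ t → IsChromaticNumber n s t 2
  χ-odd 2∤s 2∤t = chromatic (parity-colorable (m∣m*n (3 ^ u)) 2∤s 2∤t) (¬1-colorable n t 1≤s 2s≤n)

  χ-even : 2 ∣ s ⊎ 2 ∣ t → IsChromaticNumber n s t 3
  χ-even even with middleMultiplier u adm even
  ... | k , s-mid , t-mid = chromatic (middleThird-colorable n k s-mid t-mid) (odd-closed-walk even)
    where
    n∣3^u*d : ∀ {d} → 2 ∣ d → n ∣ 3 ^ u * d
    n∣3^u*d (divides d′ refl) = divides d′ (regroup (3 ^ u) d′)
      where
      regroup : ∀ x d′ → x * (d′ * 2) ≡ d′ * (2 * x)
      regroup = solve-∀
    2∤3^u = prime-∤-^ prime[2] 2∤3 u
    odd-closed-walk : 2 ∣ s ⊎ 2 ∣ t → ¬ Colorable n s t 2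
    odd-closed-walk (inj₁ 2∣s) = ¬2-colorable n t (3 ^ u) 1≤s 2s≤n 2∤3^u (n∣3^u*d 2∣s)
    odd-closed-walk (inj₂ 2∣t) = ¬2-colorable n s (3 ^ u) 1≤t 2t≤n 2∤3^u (n∣3^u*d 2∣t) ∘ colorable-swap

admissible-≤3 : ∀ v {s t} → 1 ≤ s → s ≤ 3 → 1 ≤ t → t ≤ 3 → s ≢ t → Admissible (suc v) s t
admissible-≤3 v 1≤s s≤3 1≤t t≤3 s≢t = (1≤s , ≤-trans s≤3 3≤3^u) , (1≤t , ≤-trans t≤3 3≤3^u) , s≢t
  where
  3≤3^u : 3 ≤ 3 ^ suc v
  3≤3^u = m≤m*n 3 (3 ^ v) {{m^n≢0 3 v}}

theorem3p3p4 : (∀ u s t → 1 ≤ u → Admissible u s t →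
    Σ ℕ λ k → IsChromaticNumber (2 * 3 ^ u) s t k × (k ≡ 2 ⊎ k ≡ 3))
    × (∀ u → 1 ≤ u →
    (Σ ℕ λ s → Σ ℕ λ t → Admissible u s t × IsChromaticNumber (2 * 3 ^ u) s t 2)
    × (Σ ℕ λ s → Σ ℕ λ t → Admissible u s t × IsChromaticNumber (2 * 3 ^ u) s t 3))
theorem3p3p4 = chromatic-number , examples
  where
  chromatic-number : ∀ u s t → 1 ≤ u → Admissible u s t →
                     Σ ℕ λ k → IsChromaticNumber (2 * 3 ^ u) s t k × (k ≡ 2 ⊎ k ≡ 3)
  -- u = 0 admits no admissible pair
  chromatic-number u s t _ adm with 2 ∣? s | 2 ∣? t
  ... | no 2∤s | no 2∤t = 2 , χ-odd u adm 2∤s 2∤t , inj₁ refl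
  ... | yes 2∣s | _ = 3 , χ-even u adm (inj₁ 2∣s) , inj₂ refl
  ... | no _ | yes 2∣t = 3 , χ-even u adm (inj₂ 2∣t) , inj₂ refl
  examples : ∀ u → 1 ≤ u →
             (Σ ℕ λ s → Σ ℕ λ t → Admissible u s t × IsChromaticNumber (2 * 3 ^ u) s t 2)
             × (Σ ℕ λ s → Σ ℕ λ t → Admissible u s t × IsChromaticNumber (2 * 3 ^ u) s t 3)
  examples (suc v) _ =
    (1 , 3 , adm₁₃ , χ-odd (suc v) adm₁₃ (from-no (2 ∣? 1)) (from-no (2 ∣? 3))) ,
    (1 , 2 , adm₁₂ , χ-even (suc v) adm₁₂ (inj₂ (from-yes (2 ∣? 2))))
    where
    adm₁₃ = admissible-≤3 v (s≤s z≤n) (s≤s z≤n) (s≤s z≤n) ≤-refl (λ ())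
    adm₁₂ = admissible-≤3 v (s≤s z≤n) (s≤s z≤n) (s≤s z≤n) (n≤1+n 2) (λ ())
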